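{- Consider the crowdsourcing scheduling problem described in the context. The inequality $$WCT_{OPT}\geq \frac{1}{m}M_{1}+\frac{m-1}{2m}M_{n}+M_{\Lambda}$$ does not necessarily hold. That is, there exist an instance (numbers $m,n$, rates $\lambda_j>0$, service times $\tau_i>0$, weights $w_i>0$), an indexing $s_1,\dots,s_n$ of the tasks with $\frac{w_1}{\tau_1}\ge\cdots\ge\frac{w_n}{\tau_n}$, and the assignment $\Lambda=\{\mathcal{S}_1,\dots,\mathcal{S}_m\}$ produced by the LRF algorithm run with this task order, such that $$WCT_{OPT}< \frac{1}{m}M_{1}+\frac{m-1}{2m}M_{n}+M_{\Lambda},$$ where $M_{1}=\sum_{j=1}^{n}\sum_{i\leq j} w_{j}\tau_{i}$, $M_{n}=\sum_{i=1}^{n}w_{i}\tau_{i}$ and $M_{\Lambda}=\sum_{j=1}^{m}\sum_{s_{i}\in \mathcal{S}_{j}}w_{i}\cdot \frac{2}{\lambda_{j}}$.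
   Context: Crowdsourcing scheduling problem: there are $m\ge 1$ crowd workers $u_1,\dots,u_m$, worker $u_j$ having a rate $\lambda_j>0$, and $n$ indivisible tasks $s_1,\dots,s_n$, task $s_i$ having required service time $\tau_i>0$ and weight $w_i>0$. A schedule partitions the tasks into disjoint sets $\mathcal{S}_1,\dots,\mathcal{S}_m$ ($\mathcal{S}_j$ is processed by $u_j$) and fixes a processing order within each $\mathcal{S}_j$; each worker processes its tasks sequentially. If $s_i\in\mathcal{S}_j$, its completion time is $C_i=\frac{2}{\lambda_j}+\sum\tau_k$, the sum over all tasks $s_k\in\mathcal{S}_j$ processed before $s_i$ together with $s_i$ itself. The total weighted completion time is $\sum_{i=1}^n w_iC_i$, and $WCT_{OPT}$ denotes its minimum over all schedules. LRF (Largest-Ratio-First) algorithm: the tasks are indexed so that $\frac{w_1}{\tau_1}\ge\cdots\ge\frac{w_n}{\tau_n}$ (ties in any order); initialize $\mathcal{S}_j=\emptyset$ and $EW_j=\frac{2}{\lambda_j}$ for all $j$; for $i=1,\dots,n$ in turn, pick $j_{\min}=\arg\min_k EW_k$, add $s_i$ to $\mathcal{S}_{j_{\min}}$ and increase $EW_{j_{\min}}$ by $\tau_i$. Each worker processes its tasks in the order they were assigned. -}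

module Defs where

open import Data.Nat as ℕ using (ℕ; zero; suc)
open import Data.Fin as Fin using (Fin; zero; suc; toℕ; _≟_)
open import Data.Bool using (Bool; if_then_else_)
open import Data.List using (List; []; _∷_; concat; map; allFin)
open import Data.List.Relation.Binary.Permutation.Propositional using (_↭_)
open import Data.Vec using (Vec; []; _∷_; lookup)
open import Data.Integer using (+_)
open import Data.Rational using (ℚ; 0ℚ; 1ℚ; _+_; _*_; _÷_; _≤ᵇ_; Positive; NonZero; ½)
open import Data.Rational.Properties using (pos⇒nonZero)
open import Relation.Nullary using (does)

sumF : ∀ {n} → (Fin n → ℚ) → ℚ
sumF {zero}  f = 0ℚ
sumF {suc n} f = f zero + sumF (λ i → f (suc i))

2ℚ : ℚ
2ℚ = 1ℚ + 1ℚ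

twoOver : (l : ℚ) → Positive l → ℚ
twoOver l p = (2ℚ ÷ l) {{pos⇒nonZero l {{p}}}}

ratio : (w τ : ℚ) → Positive τ → ℚ
ratio w τ p = (w ÷ τ) {{pos⇒nonZero τ {{p}}}}

-- General schedules
-- A schedule assigns to each worker j an ordered list S j of tasks
-- (processed in list order); the lists together contain every task
-- exactly once (their concatenation is a permutation of all tasks).

Schedule : ℕ → ℕ → Set
Schedule m n = Fin m → List (Fin n)

IsSchedule : ∀ {m n} → Schedule m n → Set
IsSchedule {m} {n} S = concat (map S (allFin m)) ↭ allFin n

-- weighted completion time of the tasks in a worker's list, where t is
-- the time elapsed before the next task in the list starts
-- (initially t = 2/λ_j); completion time of a task = t + its τ.
workerWCT : ∀ {n} → (τ w : Fin n → ℚ) → ℚ → List (Fin n) → ℚ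
workerWCT τ w t []       = 0ℚ
workerWCT τ w t (i ∷ is) = w i * (t + τ i) + workerWCT τ w (t + τ i) is

WCT : ∀ {m n} (rate : Fin m → ℚ) → (∀ j → Positive (rate j)) →
      (τ w : Fin n → ℚ) → Schedule m n → ℚ
WCT rate rpos τ w S = sumF (λ j → workerWCT τ w (twoOver (rate j) (rpos j)) (S j))

-- arg min with ties broken towards the smallest index
argmin : ∀ {k} → (Fin (suc k) → ℚ) → Fin (suc k)
argmin {zero}  f = zero
argmin {suc k} f with argmin (λ i → f (suc i))
... | j = if f zero ≤ᵇ f (suc j) then zero else suc j

bump : ∀ {k} → (Fin k → ℚ) → Fin k → ℚ → (Fin k → ℚ)
bump EW j x i = if does (i ≟ j) then EW i + x else EW i

lrfRun : ∀ {k n} → (Fin (suc k) → ℚ) → (Fin n → ℚ) → Vec (Fin (suc k)) n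
lrfRun {n = zero}  EW τ = []
lrfRun {n = suc n} EW τ =
  argmin EW ∷ lrfRun (bump EW (argmin EW) (τ zero)) (λ i → τ (suc i))

lrfAssign : ∀ {k n} (rate : Fin (suc k) → ℚ) → (∀ j → Positive (rate j)) →
            (τ : Fin n → ℚ) → Fin n → Fin (suc k)
lrfAssign rate rpos τ i = lookup (lrfRun (λ j → twoOver (rate j) (rpos j)) τ) i

M1 : ∀ {n} → (τ w : Fin n → ℚ) → ℚ
M1 τ w = sumF (λ j → sumF (λ i → if toℕ i ℕ.≤ᵇ toℕ j then w j * τ i else 0ℚ))

Mn : ∀ {n} → (τ w : Fin n → ℚ) → ℚ
Mn τ w = sumF (λ i → w i * τ i)

MΛ : ∀ {m n} (rate : Fin m → ℚ) → (∀ j → Positive (rate j)) →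
     (w : Fin n → ℚ) → (A : Fin n → Fin m) → ℚ
MΛ rate rpos w A =
  sumF (λ j → sumF (λ i → if does (A i ≟ j) then w i * twoOver (rate j) (rpos j) else 0ℚ))

module Submission where

open import Defs
open import Data.Nat using (ℕ; suc)
open import Data.Fin using (Fin; zero; suc)
open import Data.Product using (Σ; _×_; _,_)
open import Data.Integer using (+_)
open import Data.Rational using (ℚ; _+_; _*_; _/_; _<_; Positive; ½; _<?_; _≤?_)
open import Data.List using ([]; _∷_)
open import Data.Unit using (tt)
open import Relation.Binary.PropositionalEquality using (_≡_; refl; sym; cong; cong₂; subst₂; module ≡-Reasoning)
open import Relation.Nullary.Decidable using (toWitness)
open import Data.List.Relation.Binary.Permutation.Propositional using (↭-refl)

-- Two workers with 2/λ = 2, 1 and two tasks (τ, w) = (2, 4), (3, 5).  LRF sends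
-- s₁ to the fast worker u₂ and s₂ to u₁, so M_Λ = 4·1 + 5·2 = 14, and the
-- bound is 33/2 + 23/4 + 14 = 145/4.  The opposite assignment, which puts the
-- long task on the fast worker, costs only 4·4 + 5·4 = 36 < 145/4.

rate : Fin 2 → ℚ
rate zero       = + 1 / 1
rate (suc zero) = + 2 / 1

serviceTime : Fin 2 → ℚ
serviceTime zero       = + 2 / 1
serviceTime (suc zero) = + 3 / 1

weight : Fin 2 → ℚ
weight zero       = + 4 / 1
weight (suc zero) = + 5 / 1

rate-positive : ∀ j → Positive (rate j)
rate-positive zero       = _
rate-positive (suc zero) = _

serviceTime-positive : ∀ i → Positive (serviceTime i)
serviceTime-positive zero       = _
serviceTime-positive (suc zero) = _

weight-positive : ∀ i → Positive (weight i)
weight-positive zero       = _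
weight-positive (suc zero) = _

ratio-antitone : ∀ i j → i Data.Fin.≤ j →
  ratio (weight j) (serviceTime j) (serviceTime-positive j) Data.Rational.≤
  ratio (weight i) (serviceTime i) (serviceTime-positive i)
ratio-antitone zero       zero       _  = toWitness {a? = _ ≤? _} tt
ratio-antitone zero       (suc zero) _  = toWitness {a? = _ ≤? _} tt
ratio-antitone (suc zero) zero       ()
ratio-antitone (suc zero) (suc zero) _  = toWitness {a? = _ ≤? _} tt

longTaskOnFastWorker : Schedule 2 2
longTaskOnFastWorker zero       = zero ∷ []
longTaskOnFastWorker (suc zero) = suc zero ∷ []

WCT-longTaskOnFastWorker :
  WCT rate rate-positive serviceTime weight longTaskOnFastWorker ≡ + 36 / 1
WCT-longTaskOnFastWorker = refl

M1-example : M1 serviceTime weight ≡ + 33 / 1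
M1-example = refl

Mn-example : Mn serviceTime weight ≡ + 23 / 1
Mn-example = refl

MΛ-lrf-example :
  MΛ rate rate-positive weight (lrfAssign rate rate-positive serviceTime) ≡ + 14 / 1
MΛ-lrf-example = refl

36<145/4 : + 36 / 1 < + 145 / 4
36<145/4 = toWitness {a? = _ <? _} tt

theorem1 : Σ ℕ λ k → Σ ℕ λ n →
    Σ (Fin (suc k) → ℚ) λ rate → Σ (∀ j → Positive (rate j)) λ rpos →
    Σ (Fin n → ℚ) λ τ → Σ (∀ i → Positive (τ i)) λ τpos →
    Σ (Fin n → ℚ) λ w → Σ (∀ i → Positive (w i)) λ wpos →
    (∀ i j → i Data.Fin.≤ j → ratio (w j) (τ j) (τpos j) Data.Rational.≤ ratio (w i) (τ i) (τpos i)) ×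
    Σ (Schedule (suc k) n) λ S → IsSchedule S ×
      WCT rate rpos τ w S Data.Rational.<
        ((+ 1 / suc k) * M1 τ w + ((+ k / suc k) * ½) * Mn τ w
          + MΛ rate rpos w (lrfAssign rate rpos τ))
theorem1 =
  1 , 2 , rate , rate-positive , serviceTime , serviceTime-positive , weight , weight-positive ,
  ratio-antitone , longTaskOnFastWorker , ↭-refl , longTaskOnFastWorker<bound
  where
  bound : ℚ
  bound = (+ 1 / 2) * M1 serviceTime weight + ((+ 1 / 2) * ½) * Mn serviceTime weight
          + MΛ rate rate-positive weight (lrfAssign rate rate-positive serviceTime)

  bound-example : bound ≡ + 145 / 4
  bound-example = begin
    bound
      ≡⟨ cong₂ _+_ (cong₂ _+_ (cong ((+ 1 / 2) *_) M1-example)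
                              (cong (((+ 1 / 2) * ½) *_) Mn-example))
                   MΛ-lrf-example ⟩
    (+ 1 / 2) * (+ 33 / 1) + ((+ 1 / 2) * ½) * (+ 23 / 1) + + 14 / 1
      ≡⟨ refl ⟩
    + 145 / 4 ∎
    where open ≡-Reasoning

  longTaskOnFastWorker<bound : WCT rate rate-positive serviceTime weight longTaskOnFastWorker < bound
  longTaskOnFastWorker<bound = subst₂ _<_ (sym WCT-longTaskOnFastWorker) (sym bound-example) 36<145/4
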